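{- Let $n\ge3$. For every position $x=(x_0,x_1,\ldots,x_n)$ of Exco-Nim with parameter $n$, the Sprague–Grundy value is $\mathcal{G}(x)=g(x)$, where, with $m=\min_{1\le i\le n}x_i$, $u=\sum_{i=0}^n x_i$, $y=u-nm$ and $z=\binom{y+1}{2}+1$, $$g(x)=\begin{cases}u, & \text{if } m<z,\\ (z-1)+\big((m-z)\bmod (y+1)\big), & \text{if } m\ge z.\end{cases}$$
   Context: Exco-Nim with parameter $n$: positions are tuples $x=(x_0,x_1,\ldots,x_n)$ of nonnegative integers. A legal move $x\to x'$ is to a tuple $x'$ of nonnegative integers with $x'_j\le x_j$ for all $j$, $\sum_j x'_j<\sum_j x_j$, and $x'_i=x_i$ for at least one index $1\le i\le n$. The Sprague–Grundy function is defined recursively by $\mathcal{G}(x)=\operatorname{mex}\{\mathcal{G}(x'): x\to x'\}$, where $\operatorname{mex}(S)$ is the smallest nonnegative integer not in $S$. Here $a\bmod b\in\{0,\ldots,b-1\}$. -}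

module Defs where

open import Data.Nat using (ℕ; zero; suc; _+_; _*_; _∸_; _≤_; _<_; _⊓_)
open import Data.Nat.DivMod using (_%_)
open import Data.Nat.Combinatorics using (_C_)
open import Data.Fin using (Fin; zero; suc)
open import Data.Vec.Functional using (Vector; foldr; tail)
open import Data.Product using (Σ; _×_)
open import Relation.Binary.PropositionalEquality using (_≡_; _≢_)
open import Relation.Nullary using (Dec; yes; no)
open import Data.Nat using (_<?_)

-- A position of Exco-Nim with parameter n: x = (x_0, x_1, ..., x_n),
-- index 0 is x_0 and index (suc i) is x_{i+1}.
Position : ℕ → Set
Position n = Vector ℕ (suc n)

total : ∀ {n} → Position n → ℕ
total x = foldr _+_ 0 x

minVec : ∀ {k} → Vector ℕ (suc k) → ℕ
minVec {zero}  v = v zero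
minVec {suc k} v = v zero ⊓ minVec (tail v)

-- m = min_{1 ≤ i ≤ n} x_i   (only meaningful for n ≥ 1; value 0 for n = 0 is irrelevant)
minTail : ∀ {n} → Position n → ℕ
minTail {zero}  x = 0
minTail {suc k} x = minVec (tail x)

Move : ∀ {n} → Position n → Position n → Set
Move {n} x x' =
  (∀ j → x' j ≤ x j) ×
  (total x' < total x) ×
  Σ (Fin n) (λ i → x' (suc i) ≡ x (suc i))

IsSG : ∀ {n} → (Position n → ℕ) → Set
IsSG {n} G = ∀ (x : Position n) →
  (∀ x' → Move x x' → G x' ≢ G x) ×
  (∀ k → k < G x → Σ (Position n) (λ x' → Move x x' × G x' ≡ k))

mOf uOf yOf zOf : ∀ {n} → Position n → ℕ
mOf x = minTail x
uOf x = total x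
yOf {n} x = uOf x ∸ n * mOf x
zOf x = (suc (yOf x) C 2) + 1

g : ∀ {n} → Position n → ℕ
g x with mOf x <? zOf x
... | yes _ = uOf x
... | no _  = (zOf x ∸ 1) + ((mOf x ∸ zOf x) % suc (yOf x))

module Submission where

-- Write T y = 0 + 1 + ⋯ + y = C(y+1,2).  The formula g sees a position x only
-- through m = min(x₁,…,xₙ) and y = u − n·m, where u = n·m + y is the total:
-- g x = reducedValue n m y, which is n·m + y when m ≤ T y and otherwise cycles
-- with period y + 1 through the block [T y, T (y+1)).  The proof therefore runs
-- in a reduced game on pairs (m , y).
--   * Arithmetic: reducedValue differs between (m , y) and each of its
--     *options* (pairs with smaller total, m' ≤ m and m ≤ m' + y'), and every
--     smaller value is the value of a *reachable* pair (same m and smaller y,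
--     or m lowered by d > 0 with d ≤ y' ≤ y + (n−1)d).
--   * Geometry: every move x → x' produces an option of (m , y), and, for
--     n ≥ 3, every reachable pair is produced by some move; the move is found
--     by interpolating between a lower and an upper vector.
-- Hence g satisfies the mex recursion, and since Sprague–Grundy functions are
-- unique (induction on the total) every such function equals g.

open import Defs
open import Data.Nat using (ℕ; _≤_)
open import Data.Product using (_×_)
open import Relation.Binary.PropositionalEquality using (_≡_)
open import Data.Nat
open import Data.Nat.Properties
open import Data.Nat.DivMod
open import Data.Nat.Divisibility using (_∣_; ∣⇒≤; ∣m+n∣m⇒∣n; n∣m*n; m%n≡0⇒n∣m)
open import Data.Nat.Combinatorics using (_C_; nC1≡n; nCk+nC[k+1]≡[n+1]C[k+1])
open import Data.Nat.Tactic.RingSolver using (solve-∀)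
open import Data.Fin using (Fin; zero; suc)
open import Data.Fin.Properties using () renaming (_≟_ to _≟ᶠ_)
open import Data.Vec.Functional using (Vector; foldr; tail; _∷_; replicate; updateAt)
open import Data.Vec.Functional.Properties using (updateAt-updates; updateAt-minimal)
open import Data.Product using (Σ-syntax; _,_; proj₁; proj₂)
open import Data.Sum using (_⊎_; inj₁; inj₂)
open import Data.Empty using (⊥-elim)
open import Function using (const)
open import Relation.Nullary using (Dec; yes; no)
open import Relation.Binary.Definitions using (tri<; tri≈; tri>)
open import Relation.Binary.PropositionalEquality
  using (_≢_; refl; sym; trans; cong; cong₂; subst; subst₂; module ≡-Reasoning)

tri : ℕ → ℕ
tri zero    = 0
tri (suc y) = suc y + tri y

C2≡tri : ∀ y → suc y C 2 ≡ tri y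
C2≡tri zero    = refl
C2≡tri (suc y) = begin
  suc (suc y) C 2        ≡⟨ nCk+nC[k+1]≡[n+1]C[k+1] (suc y) 1 ⟨
  suc y C 1 + suc y C 2  ≡⟨ cong₂ _+_ (nC1≡n (suc y)) (C2≡tri y) ⟩
  suc y + tri y          ∎
  where open ≡-Reasoning

tri-mono-≤ : ∀ {a b} → a ≤ b → tri a ≤ tri b
tri-mono-≤ {zero}          _         = z≤n
tri-mono-≤ {suc a} {suc b} (s≤s a≤b) = +-mono-≤ (s≤s a≤b) (tri-mono-≤ a≤b)

tri-cancel-< : ∀ {a b} → tri a < tri b → a < b
tri-cancel-< lt = ≰⇒> (λ b≤a → <⇒≱ lt (tri-mono-≤ b≤a))

tri-decompose : ∀ k → Σ[ b ∈ ℕ ] Σ[ j ∈ ℕ ] j ≤ b × tri b + j ≡ k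
tri-decompose zero = 0 , 0 , z≤n , refl
tri-decompose (suc k) with tri-decompose k
... | b , j , j≤b , eq with m≤n⇒m<n∨m≡n j≤b
...   | inj₁ j<b  = b , suc j , j<b , trans (+-suc (tri b) j) (cong suc eq)
...   | inj₂ refl = suc j , 0 , z≤n ,
                    trans (+-identityʳ _) (cong suc (trans (+-comm j (tri j)) eq))

tri-block-unique : ∀ {y y' v} → tri y ≤ v → v < tri (suc y) →
                   tri y' ≤ v → v < tri (suc y') → y ≡ y'
tri-block-unique lo hi lo' hi' =
  ≤-antisym (≤-pred (tri-cancel-< (≤-<-trans lo hi')))
            (≤-pred (tri-cancel-< (≤-<-trans lo' hi)))

%-shift-≢ : ∀ a {d p} .{{_ : NonZero p}} → 0 < d → d < p → a % p ≢ (a + d) % p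
%-shift-≢ a {d} {p} 0<d d<p same = <⇒≱ d<p (∣⇒≤ {{>-nonZero 0<d}} p∣d)
  where
  open ≡-Reasoning
  quotients : a / p * p + d ≡ (a + d) / p * p
  quotients = +-cancelˡ-≡ (a % p) _ _ (begin
    a % p + (a / p * p + d)        ≡⟨ +-assoc (a % p) _ d ⟨
    a % p + a / p * p + d          ≡⟨ cong (_+ d) (m≡m%n+[m/n]*n a p) ⟨
    a + d                          ≡⟨ m≡m%n+[m/n]*n (a + d) p ⟩
    (a + d) % p + (a + d) / p * p  ≡⟨ cong (_+ (a + d) / p * p) same ⟨
    a % p + (a + d) / p * p        ∎)
  p∣d : p ∣ d
  p∣d = ∣m+n∣m⇒∣n (subst (p ∣_) (sym quotients) (n∣m*n ((a + d) / p))) (n∣m*n (a / p))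

%-adjust : ∀ B j p .{{_ : NonZero p}} → j < p → j ≤ B → (B ∸ (B ∸ j) % p) % p ≡ j
%-adjust B j p j<p j≤B = begin
  (B ∸ t) % p              ≡⟨ cong (λ b → (b ∸ t) % p) (m+[n∸m]≡n j≤B) ⟨
  (j + c ∸ t) % p          ≡⟨ cong (_% p) (+-∸-assoc j (m%n≤m c p)) ⟩
  (j + (c ∸ t)) % p        ≡⟨ cong (λ c' → (j + (c' ∸ t)) % p) (m≡m%n+[m/n]*n c p) ⟩
  (j + (t + q * p ∸ t)) % p ≡⟨ cong (λ r → (j + r) % p) (m+n∸m≡n t (q * p)) ⟩
  (j + q * p) % p          ≡⟨ [m+kn]%n≡m%n j q p ⟩
  j % p                    ≡⟨ m<n⇒m%n≡m j<p ⟩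
  j                        ∎
  where
  open ≡-Reasoning
  c = B ∸ j
  t = c % p
  q = c / p

%-adjust-zero : ∀ B j p .{{_ : NonZero p}} → j < p → j ≤ B → (B ∸ j) % p ≡ 0 → B % p ≡ j
%-adjust-zero B j p j<p j≤B t≡0 = begin
  B % p              ≡⟨ cong (_% p) (m+[n∸m]≡n j≤B) ⟨
  (j + (B ∸ j)) % p  ≡⟨ %-remove-+ʳ j (m%n≡0⇒n∣m (B ∸ j) p t≡0) ⟩
  j % p              ≡⟨ m<n⇒m%n≡m j<p ⟩
  j                  ∎
  where open ≡-Reasoning

cycleValue : ℕ → ℕ → ℕ
cycleValue m y = tri y + (m ∸ suc (tri y)) % suc y

reducedValue : ℕ → ℕ → ℕ → ℕ
reducedValue n m y with m ≤? tri y
... | yes _ = n * m + y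
... | no  _ = cycleValue m y

reducedValue-low : ∀ n {m y} → m ≤ tri y → reducedValue n m y ≡ n * m + y
reducedValue-low n {m} {y} m≤T with m ≤? tri y
... | yes _  = refl
... | no m≰T = ⊥-elim (m≰T m≤T)

reducedValue-high : ∀ n {m y} → tri y < m → reducedValue n m y ≡ cycleValue m y
reducedValue-high n {m} {y} T<m with m ≤? tri y
... | yes m≤T = ⊥-elim (<⇒≱ T<m m≤T)
... | no _    = refl

cycleValue-≥ : ∀ m y → tri y ≤ cycleValue m y
cycleValue-≥ m y = m≤m+n (tri y) _

cycleValue-< : ∀ m y → cycleValue m y < tri (suc y)
cycleValue-< m y = begin-strict
  tri y + (m ∸ suc (tri y)) % suc y  <⟨ +-monoʳ-< (tri y) (m%n<n (m ∸ suc (tri y)) (suc y)) ⟩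
  tri y + suc y                      ≡⟨ +-comm (tri y) (suc y) ⟩
  tri (suc y)                        ∎
  where open ≤-Reasoning

cycleValue-<m : ∀ {m y} → tri y < m → cycleValue m y < m
cycleValue-<m {m} {y} T<m = begin-strict
  tri y + (m ∸ suc (tri y)) % suc y  ≤⟨ +-monoʳ-≤ (tri y) (m%n≤m (m ∸ suc (tri y)) (suc y)) ⟩
  tri y + (m ∸ suc (tri y))          <⟨ +-monoʳ-< (tri y) (∸-monoʳ-< (n<1+n (tri y)) T<m) ⟩
  tri y + (m ∸ tri y)                ≡⟨ m+[n∸m]≡n (<⇒≤ T<m) ⟩
  m                                  ∎
  where open ≤-Reasoning

reducedValue-≤ : ∀ n1 m y → reducedValue (suc n1) m y ≤ suc n1 * m + y
reducedValue-≤ n1 m y with m ≤? tri y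
... | yes _  = ≤-refl
... | no m≰T = ≤-trans (<⇒≤ (cycleValue-<m (≰⇒> m≰T)))
                       (≤-trans (m≤m+n m (n1 * m)) (m≤m+n _ y))

-- The reduced game for n = n1 + 1.  (m', y') is an *option* of (m, y) when it
-- satisfies the conditions every move obeys (see move⇒option) …
Option : ℕ → ℕ → ℕ → ℕ → ℕ → Set
Option n1 m y m' y' = suc n1 * m' + y' < suc n1 * m + y × m' ≤ m × m ≤ m' + y'

-- … and it is *reachable* when it satisfies the conditions under which a move
-- can be built (see reachable⇒move): y decreases with m fixed, or m drops by
-- some d > 0 and d ≤ y' ≤ y + n1·d.
Reachable : ℕ → ℕ → ℕ → ℕ → ℕ → Set
Reachable n1 m y m' y' =
  (m' ≡ m × y' < y) ⊎ (Σ[ d ∈ ℕ ] 0 < d × m' + d ≡ m × d ≤ y' × y' ≤ y + n1 * d)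

-- Two pairs in the cycle regime with the same y and 0 < m − m' ≤ y have
-- different values, since their residues differ by m − m'.
cycleValue-injective : ∀ {m m' y} → tri y < m' → m' < m → m ≤ m' + y →
                       cycleValue m' y ≢ cycleValue m y
cycleValue-injective {m} {m'} {y} T<m' m'<m m≤m'+y same =
  %-shift-≢ (m' ∸ z) (m<n⇒0<n∸m m'<m) d<1+y
            (trans (+-cancelˡ-≡ (tri y) _ _ same) (cong (_% suc y) m∸z≡))
  where
  z = suc (tri y)
  d = m ∸ m'
  d<1+y : d < suc y
  d<1+y = s≤s (subst (d ≤_) (m+n∸m≡n m' y) (∸-monoˡ-≤ m' m≤m'+y))
  m∸z≡ : m ∸ z ≡ m' ∸ z + d
  m∸z≡ = trans (cong (_∸ z) (sym (m+[n∸m]≡n (<⇒≤ m'<m)))) (+-∸-comm d T<m')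

reducedValue-distinct : ∀ n1 {m y m' y'} → Option n1 m y m' y' →
                        reducedValue (suc n1) m' y' ≢ reducedValue (suc n1) m y
reducedValue-distinct n1 {m} {y} {m'} {y'} (smaller , m'≤m , m≤m'+y') same
  with m ≤? tri y
... | yes _ = <⇒≢ (≤-<-trans (reducedValue-≤ n1 m' y') smaller) same
... | no m≰T with m' ≤? tri y'
...   | yes _ = <⇒≱ (cycleValue-<m (≰⇒> m≰T)) (begin
          m                    ≤⟨ m≤m'+y' ⟩
          m' + y'              ≤⟨ +-monoˡ-≤ y' (m≤m+n m' (n1 * m')) ⟩
          suc n1 * m' + y'     ≡⟨ same ⟩
          cycleValue m y       ∎)
  where open ≤-Reasoning
...   | no m'≰T' with tri-block-unique {y'} {y} (cycleValue-≥ m' y') (cycleValue-< m' y')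
                               (subst (tri y ≤_) (sym same) (cycleValue-≥ m y))
                               (subst (_< tri (suc y)) (sym same) (cycleValue-< m y))
...     | refl with m≤n⇒m<n∨m≡n m'≤m
...       | inj₁ m'<m = cycleValue-injective (≰⇒> m'≰T') m'<m m≤m'+y' same
...       | inj₂ refl = <-irrefl refl smaller

ReachesValue : ℕ → ℕ → ℕ → ℕ → Set
ReachesValue n1 m y k =
  Σ[ m' ∈ ℕ ] Σ[ y' ∈ ℕ ] Reachable n1 m y m' y' × reducedValue (suc n1) m' y' ≡ k

lower-reachable : ∀ n1 {m y b} t → t ≤ b → t ≤ m → b < y ⊎ (0 < t × b ≤ y) →
                  Reachable n1 m y (m ∸ t) b
lower-reachable n1 zero    _   _   (inj₁ b<y)      = inj₁ (refl , b<y)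
lower-reachable n1 (suc t) t≤b t≤m (inj₁ b<y)      =
  inj₂ (suc t , z<s , m∸n+n≡m t≤m , t≤b , ≤-trans (<⇒≤ b<y) (m≤m+n _ _))
lower-reachable n1 (suc t) t≤b t≤m (inj₂ (_ , b≤y)) =
  inj₂ (suc t , z<s , m∸n+n≡m t≤m , t≤b , ≤-trans b≤y (m≤m+n _ _))

-- A value T b + j < m (j ≤ b) is reached by keeping y' = b and lowering m by
-- t < b + 1 so that the cycle lands on j.  If the cycle is already at j we
-- would need t = 0, which is only allowed when b < y.
cycle-reachesValue : ∀ n1 {m y b j} → j ≤ b → tri b + j < m →
                     b < y ⊎ (b ≤ y × (m ∸ suc (tri b)) % suc b ≢ j) →
                     ReachesValue n1 m y (tri b + j)
cycle-reachesValue n1 {m} {y} {b} {j} j≤b below side =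
  m ∸ t , b , lower-reachable n1 t t≤b t≤m (shifted side) , value
  where
  z = suc (tri b)
  B = m ∸ z
  t = (B ∸ j) % suc b
  z≤m : z ≤ m
  z≤m = ≤-trans (s≤s (m≤m+n (tri b) j)) below
  j≤B : j ≤ B
  j≤B = subst (_≤ B) (m+n∸m≡n z j) (∸-monoˡ-≤ z below)
  t≤B : t ≤ B
  t≤B = ≤-trans (m%n≤m (B ∸ j) (suc b)) (m∸n≤m B j)
  t≤b : t ≤ b
  t≤b = ≤-pred (m%n<n (B ∸ j) (suc b))
  t≤m : t ≤ m
  t≤m = ≤-trans t≤B (m∸n≤m m z)
  shifted : b < y ⊎ (b ≤ y × B % suc b ≢ j) → b < y ⊎ (0 < t × b ≤ y)
  shifted (inj₁ b<y)         = inj₁ b<y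
  shifted (inj₂ (b≤y , B≢j)) =
    inj₂ (n≢0⇒n>0 (λ t≡0 → B≢j (%-adjust-zero B j (suc b) (s≤s j≤b) j≤B t≡0)) , b≤y)
  above : tri b < m ∸ t
  above = subst (_≤ m ∸ t) (m∸[m∸n]≡n z≤m) (∸-monoʳ-≤ m t≤B)
  m∸t∸z≡B∸t : m ∸ t ∸ z ≡ B ∸ t
  m∸t∸z≡B∸t = trans (∸-+-assoc m t z) (trans (cong (m ∸_) (+-comm t z)) (sym (∸-+-assoc m z t)))
  value : reducedValue (suc n1) (m ∸ t) b ≡ tri b + j
  value = trans (reducedValue-high (suc n1) above)
                (cong (tri b +_) (trans (cong (_% suc b) m∸t∸z≡B∸t)
                                        (%-adjust B j (suc b) (s≤s j≤b) j≤B)))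

toZero-reachable : ∀ n1 {y k} m → m ≤ k → k + m < suc n1 * m + y → Reachable n1 m y 0 k
toZero-reachable n1 {y} {k} zero _ below =
  inj₁ (refl , subst₂ _<_ (+-identityʳ k) (cong (_+ y) (*-zeroʳ (suc n1))) below)
toZero-reachable n1 {y} {k} (suc m) m≤k below =
  inj₂ (suc m , z<s , refl , m≤k , <⇒≤ (+-cancelʳ-< (suc m) k _ (begin-strict
    k + suc m              <⟨ below ⟩
    suc n1 * suc m + y     ≡⟨ regroup n1 (suc m) y ⟩
    y + n1 * suc m + suc m ∎)))
  where
  open ≤-Reasoning
  regroup : ∀ n1 m y → suc n1 * m + y ≡ y + n1 * m + m
  regroup = solve-∀

-- In the regime m ≤ T y a value m ≤ k < n·m + y is reached by lowering m by
-- e = n·m + y − k and raising y by n1·e, or, when e > m, by emptying to m' = 0.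
linear-reachesValue : ∀ n1 .{{_ : NonZero n1}} {m y k} → m ≤ tri y → m ≤ k →
                      k < suc n1 * m + y → ReachesValue n1 m y k
linear-reachesValue n1 {m} {y} {k} m≤T m≤k k<u with (suc n1 * m + y ∸ k) ≤? m
... | yes e≤m = m ∸ e , y + n1 * e ,
                inj₂ (e , m<n⇒0<n∸m k<u , m∸n+n≡m e≤m , e≤y' , ≤-refl) ,
                trans (reducedValue-low (suc n1) stillLow) value
  where
  open ≡-Reasoning
  e = suc n1 * m + y ∸ k
  e≤y' : e ≤ y + n1 * e
  e≤y' = ≤-trans (m≤n*m e n1) (m≤n+m _ y)
  stillLow : m ∸ e ≤ tri (y + n1 * e)
  stillLow = ≤-trans (m∸n≤m m e) (≤-trans m≤T (tri-mono-≤ (m≤m+n y _)))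
  regroup : ∀ n1 a y e → suc n1 * a + (y + n1 * e) + e ≡ suc n1 * (a + e) + y
  regroup = solve-∀
  value : suc n1 * (m ∸ e) + (y + n1 * e) ≡ k
  value = +-cancelʳ-≡ e _ _ (begin
    suc n1 * (m ∸ e) + (y + n1 * e) + e  ≡⟨ regroup n1 (m ∸ e) y e ⟩
    suc n1 * (m ∸ e + e) + y             ≡⟨ cong (λ a → suc n1 * a + y) (m∸n+n≡m e≤m) ⟩
    suc n1 * m + y                       ≡⟨ m+[n∸m]≡n (<⇒≤ k<u) ⟨
    k + e                                ∎)
... | no e≰m = 0 , k , toZero-reachable n1 m m≤k k+m<u ,
               trans (reducedValue-low (suc n1) z≤n) (cong (_+ k) (*-zeroʳ (suc n1)))
  where
  k+m<u : k + m < suc n1 * m + y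
  k+m<u = subst (k + m <_) (m+[n∸m]≡n (<⇒≤ k<u)) (+-monoʳ-< k (≰⇒> e≰m))

reducedValue-mex : ∀ n1 .{{_ : NonZero n1}} {m y k} → k < reducedValue (suc n1) m y →
                   ReachesValue n1 m y k
reducedValue-mex n1 {m} {y} {k} k<F with m ≤? tri y | tri-decompose k
... | yes m≤T | b , j , j≤b , refl with tri b + j <? m
...   | yes k<m = cycle-reachesValue n1 j≤b k<m
                    (inj₁ (tri-cancel-< (≤-<-trans (m≤m+n _ j) (<-≤-trans k<m m≤T))))
...   | no  k≮m = linear-reachesValue n1 m≤T (≮⇒≥ k≮m) k<F
reducedValue-mex n1 {m} {y} {k} k<F | no m≰T | b , j , j≤b , refl =
  cycle-reachesValue n1 j≤b (<-trans k<F (cycleValue-<m (≰⇒> m≰T))) side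
  where
  b≤y : b ≤ y
  b≤y = ≤-pred (tri-cancel-< (≤-<-trans (m≤m+n (tri b) j) (<-trans k<F (cycleValue-< m y))))
  side : b < y ⊎ (b ≤ y × (m ∸ suc (tri b)) % suc b ≢ j)
  side with m≤n⇒m<n∨m≡n b≤y
  ... | inj₁ b<y = inj₁ b<y
  ... | inj₂ b≡y = inj₂ (b≤y , λ r≡j → <⇒≢ j<r (sym r≡j))
    where
    j<r : j < (m ∸ suc (tri b)) % suc b
    j<r = +-cancelˡ-< (tri b) j _ (subst (λ c → tri b + j < cycleValue m c) (sym b≡y) k<F)

vsum : ∀ {k} → Vector ℕ k → ℕ
vsum = foldr _+_ 0

_[_]≔_ : ∀ {k} → Vector ℕ k → Fin k → ℕ → Vector ℕ k
v [ i ]≔ c = updateAt v i (const c)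

vsum-≔ : ∀ {k} (v : Vector ℕ k) i c → vsum (v [ i ]≔ c) + v i ≡ vsum v + c
vsum-≔ v zero    c = swap (v zero) (vsum (tail v)) c
  where
  swap : ∀ a s c → c + s + a ≡ a + s + c
  swap = solve-∀
vsum-≔ v (suc i) c = begin
  v zero + vsum (tail v [ i ]≔ c) + v (suc i)    ≡⟨ +-assoc (v zero) _ _ ⟩
  v zero + (vsum (tail v [ i ]≔ c) + v (suc i))  ≡⟨ cong (v zero +_) (vsum-≔ (tail v) i c) ⟩
  v zero + (vsum (tail v) + c)                   ≡⟨ +-assoc (v zero) _ c ⟨
  v zero + vsum (tail v) + c                     ∎
  where open ≡-Reasoning

≔-pres-≤ : ∀ {k} {v w : Vector ℕ k} i {c} → (∀ j → v j ≤ w j) → c ≤ w i →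
           ∀ j → (v [ i ]≔ c) j ≤ w j
≔-pres-≤ {v = v} i {c} v≤w c≤wi j with j ≟ᶠ i
... | yes refl = subst (_≤ _) (sym (updateAt-updates i v)) c≤wi
... | no  j≢i  = subst (_≤ _) (sym (updateAt-minimal j i v j≢i)) (v≤w j)

≔-pres-≥ : ∀ {k} {v w : Vector ℕ k} i {c} → (∀ j → w j ≤ v j) → w i ≤ c →
           ∀ j → w j ≤ (v [ i ]≔ c) j
≔-pres-≥ {v = v} i {c} w≤v wi≤c j with j ≟ᶠ i
... | yes refl = subst (_ ≤_) (sym (updateAt-updates i v)) wi≤c
... | no  j≢i  = subst (_ ≤_) (sym (updateAt-minimal j i v j≢i)) (w≤v j)

vsum-replicate : ∀ k c → vsum (replicate k c) ≡ k * c
vsum-replicate zero    c = refl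
vsum-replicate (suc k) c = cong (c +_) (vsum-replicate k c)

vsum-mono-≤ : ∀ {k} {v w : Vector ℕ k} → (∀ j → v j ≤ w j) → vsum v ≤ vsum w
vsum-mono-≤ {zero}  _   = ≤-refl
vsum-mono-≤ {suc k} v≤w = +-mono-≤ (v≤w zero) (vsum-mono-≤ (λ j → v≤w (suc j)))

vsum-≥ : ∀ {k} (v : Vector ℕ k) {c} → (∀ j → c ≤ v j) → k * c ≤ vsum v
vsum-≥ {k} v {c} c≤v = subst (_≤ vsum v) (vsum-replicate k c) (vsum-mono-≤ c≤v)

vsum-≥-one : ∀ {k} (v : Vector ℕ (suc k)) {c} i → (∀ j → c ≤ v j) → v i + k * c ≤ vsum v
vsum-≥-one {k} v {c} i c≤v = +-cancelʳ-≤ c _ _ (begin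
  v i + k * c + c          ≡⟨ regroup (v i) (k * c) c ⟩
  suc k * c + v i          ≤⟨ +-monoˡ-≤ (v i) (vsum-≥ (v [ i ]≔ c) c≤v[i≔c]) ⟩
  vsum (v [ i ]≔ c) + v i  ≡⟨ vsum-≔ v i c ⟩
  vsum v + c               ∎)
  where
  open ≤-Reasoning
  c≤v[i≔c] : ∀ j → c ≤ (v [ i ]≔ c) j
  c≤v[i≔c] = ≔-pres-≥ i c≤v ≤-refl
  regroup : ∀ a b c → a + b + c ≡ c + b + a
  regroup = solve-∀

vsum-≥-two : ∀ {k} (v : Vector ℕ (suc (suc k))) {c} a b → a ≢ b → (∀ j → c ≤ v j) →
             v a + v b + k * c ≤ vsum v
vsum-≥-two {k} v {c} a b a≢b c≤v = +-cancelʳ-≤ c _ _ (begin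
  v a + v b + k * c + c             ≡⟨ regroup (v a) (v b) (k * c) c ⟩
  v b + (c + k * c) + v a           ≡⟨ cong (λ vb → vb + (c + k * c) + v a) v[a≔c]b≡vb ⟨
  (v [ a ]≔ c) b + suc k * c + v a  ≤⟨ +-monoˡ-≤ (v a) (vsum-≥-one (v [ a ]≔ c) b c≤v[a≔c]) ⟩
  vsum (v [ a ]≔ c) + v a           ≡⟨ vsum-≔ v a c ⟩
  vsum v + c                        ∎)
  where
  open ≤-Reasoning
  v[a≔c]b≡vb : (v [ a ]≔ c) b ≡ v b
  v[a≔c]b≡vb = updateAt-minimal b a v (λ b≡a → a≢b (sym b≡a))
  c≤v[a≔c] : ∀ j → c ≤ (v [ a ]≔ c) j
  c≤v[a≔c] = ≔-pres-≥ a c≤v ≤-refl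
  regroup : ∀ a b d c → a + b + d + c ≡ b + (c + d) + a
  regroup = solve-∀

interpolate : ∀ {k} (l v : Vector ℕ k) s → (∀ j → l j ≤ v j) → vsum l ≤ s → s ≤ vsum v →
              Σ[ w ∈ Vector ℕ k ] (∀ j → l j ≤ w j) × (∀ j → w j ≤ v j) × vsum w ≡ s
interpolate {zero}  l v zero    _ _ _  = l , (λ ()) , (λ ()) , refl
interpolate {suc k} l v s l≤v ls sv with s ≤? l zero + vsum (tail v)
... | yes s≤ =
  let w , l≤w , w≤v , Σw = interpolate (tail l) (tail v) (s ∸ l zero) (λ j → l≤v (suc j))
                             (subst (_≤ s ∸ l zero) (m+n∸m≡n (l zero) _)
                                    (∸-monoˡ-≤ (l zero) ls))
                             (subst (s ∸ l zero ≤_) (m+n∸m≡n (l zero) _)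
                                    (∸-monoˡ-≤ (l zero) s≤))
  in  l zero ∷ w , (λ { zero → ≤-refl ; (suc j) → l≤w j }) ,
      (λ { zero → l≤v zero ; (suc j) → w≤v j }) ,
      trans (cong (l zero +_) Σw) (m+[n∸m]≡n (≤-trans (m≤m+n (l zero) _) ls))
... | no s≰ =
  let w , l≤w , w≤v , Σw = interpolate (tail l) (tail v) (vsum (tail v)) (λ j → l≤v (suc j))
                             (vsum-mono-≤ (λ j → l≤v (suc j))) ≤-refl
  in  s ∸ vsum (tail v) ∷ w ,
      (λ { zero → subst (_≤ s ∸ vsum (tail v)) (m+n∸n≡m (l zero) (vsum (tail v)))
                        (∸-monoˡ-≤ (vsum (tail v)) (<⇒≤ (≰⇒> s≰)))
         ; (suc j) → l≤w j }) ,
      (λ { zero → subst (s ∸ vsum (tail v) ≤_) (m+n∸n≡m (v zero) (vsum (tail v)))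
                        (∸-monoˡ-≤ (vsum (tail v)) sv)
         ; (suc j) → w≤v j }) ,
      trans (cong (s ∸ vsum (tail v) +_) Σw)
            (m∸n+n≡m (≤-trans (m≤n+m _ (l zero)) (<⇒≤ (≰⇒> s≰))))

minVec-≤ : ∀ {k} (v : Vector ℕ (suc k)) i → minVec v ≤ v i
minVec-≤ {zero}  v zero    = ≤-refl
minVec-≤ {suc k} v zero    = m⊓n≤m (v zero) _
minVec-≤ {suc k} v (suc i) = ≤-trans (m⊓n≤n (v zero) _) (minVec-≤ (tail v) i)

minVec-greatest : ∀ {k} (v : Vector ℕ (suc k)) {c} → (∀ i → c ≤ v i) → c ≤ minVec v
minVec-greatest {zero}  v c≤v = c≤v zero
minVec-greatest {suc k} v c≤v = ⊓-glb (c≤v zero) (minVec-greatest (tail v) (λ i → c≤v (suc i)))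

minVec-attained : ∀ {k} (v : Vector ℕ (suc k)) → Σ[ i ∈ Fin (suc k) ] v i ≡ minVec v
minVec-attained {zero}  v = zero , refl
minVec-attained {suc k} v with ≤-total (v zero) (minVec (tail v))
... | inj₁ v₀≤ = zero , sym (m≤n⇒m⊓n≡m v₀≤)
... | inj₂ ≤v₀ = let i , vi≡ = minVec-attained (tail v) in
                 suc i , trans vi≡ (sym (m≥n⇒m⊓n≡n ≤v₀))

total≡ : ∀ {n1} (x : Position (suc n1)) → total x ≡ suc n1 * mOf x + yOf x
total≡ x = sym (m+[n∸m]≡n (≤-trans (vsum-≥ (tail x) (minVec-≤ (tail x))) (m≤n+m _ (x zero))))

-- Every move leads to an option: the total drops, the minimum cannot grow, and
-- the fixed coordinate x'ᵢ = xᵢ ≥ m is at most m' + y' since the other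
-- counted coordinates of x' are ≥ m'.
move⇒option : ∀ {n1} (x x' : Position (suc n1)) → Move x x' →
              Option n1 (mOf x) (yOf x) (mOf x') (yOf x')
move⇒option {n1} x x' (x'≤x , smaller , i , fixed) =
  subst₂ _<_ (total≡ x') (total≡ x) smaller ,
  minVec-greatest (tail x) (λ j → ≤-trans (minVec-≤ (tail x') j) (x'≤x (suc j))) ,
  ≤-trans (minVec-≤ (tail x) i) (subst (_≤ mOf x' + yOf x') fixed x'ᵢ≤m'+y')
  where
  open ≤-Reasoning
  regroup : ∀ n1 a b → suc n1 * a + b ≡ a + b + n1 * a
  regroup = solve-∀
  x'ᵢ≤m'+y' : x' (suc i) ≤ mOf x' + yOf x'
  x'ᵢ≤m'+y' = +-cancelʳ-≤ (n1 * mOf x') _ _ (begin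
    x' (suc i) + n1 * mOf x'        ≤⟨ vsum-≥-one (tail x') i (minVec-≤ (tail x')) ⟩
    vsum (tail x')                  ≤⟨ m≤n+m _ (x' zero) ⟩
    total x'                        ≡⟨ total≡ x' ⟩
    suc n1 * mOf x' + yOf x'        ≡⟨ regroup n1 (mOf x') (yOf x') ⟩
    mOf x' + yOf x' + n1 * mOf x'   ∎)

-- Realising a total s with new minimum m' by a move that keeps xᵢ and lowers
-- x_k to m': the result is interpolated between the lower vector
-- (0, m', …, xᵢ, …, m') and the upper vector x[k ≔ m'], which needs
-- n1·m' + xᵢ ≤ s and s + x_k ≤ u + m'.  (If i = k then xᵢ must equal m'.)
fixAndLower : ∀ {n1} (x : Position (suc n1)) (m' s : ℕ) (i k : Fin (suc n1)) →
  (∀ j → m' ≤ x (suc j)) → (i ≡ k → x (suc i) ≤ m') →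
  n1 * m' + x (suc i) ≤ s → s + x (suc k) ≤ total x + m' → s < total x →
  Σ[ x' ∈ Position (suc n1) ] Move x x' × mOf x' ≡ m' × total x' ≡ s
fixAndLower {n1} x m' s i k m'≤x i≡k⇒ lowS upS s<u =
  w , (w≤x , subst (_< total x) (sym Σw) s<u , i , w-fixed) , w-min , Σw
  where
  open ≤-Reasoning
  constant : Vector ℕ (suc n1)
  constant = replicate (suc n1) m'
  lower upper : Position (suc n1)
  lower = 0 ∷ (constant [ i ]≔ x (suc i))
  upper = x zero ∷ (tail x [ k ]≔ m')
  m'≤lower : ∀ j → m' ≤ lower (suc j)
  m'≤lower = ≔-pres-≥ i (λ _ → ≤-refl) (m'≤x i)
  m'≤upper : ∀ j → m' ≤ upper (suc j)
  m'≤upper = ≔-pres-≥ k m'≤x ≤-refl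
  xi≤upper : x (suc i) ≤ upper (suc i)
  xi≤upper with i ≟ᶠ k
  ... | yes refl = subst (x (suc i) ≤_) (sym (updateAt-updates i (tail x))) (i≡k⇒ refl)
  ... | no  i≢k = ≤-reflexive (sym (updateAt-minimal i k (tail x) i≢k))
  lower≤upper : ∀ j → lower j ≤ upper j
  lower≤upper zero    = z≤n
  lower≤upper (suc j) = ≔-pres-≤ i m'≤upper xi≤upper j
  upper≤x : ∀ j → upper j ≤ x j
  upper≤x zero    = ≤-refl
  upper≤x (suc j) = ≔-pres-≤ k (λ _ → ≤-refl) (m'≤x k) j
  Σlower≤s : total lower ≤ s
  Σlower≤s = +-cancelʳ-≤ m' _ _ (begin
    vsum (constant [ i ]≔ x (suc i)) + m'  ≡⟨ vsum-≔ constant i (x (suc i)) ⟩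
    vsum constant + x (suc i)              ≡⟨ cong (_+ x (suc i)) (vsum-replicate (suc n1) m') ⟩
    m' + n1 * m' + x (suc i)               ≡⟨ +-assoc m' _ _ ⟩
    m' + (n1 * m' + x (suc i))             ≤⟨ +-monoʳ-≤ m' lowS ⟩
    m' + s                                 ≡⟨ +-comm m' s ⟩
    s + m'                                 ∎)
  s≤Σupper : s ≤ total upper
  s≤Σupper = +-cancelʳ-≤ (x (suc k)) _ _ (begin
    s + x (suc k)                                        ≤⟨ upS ⟩
    x zero + vsum (tail x) + m'                          ≡⟨ +-assoc (x zero) _ m' ⟩
    x zero + (vsum (tail x) + m')                        ≡⟨ cong (x zero +_) (vsum-≔ (tail x) k m') ⟨
    x zero + (vsum (tail x [ k ]≔ m') + x (suc k))       ≡⟨ +-assoc (x zero) _ _ ⟨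
    total upper + x (suc k)                              ∎)
  interpolated = interpolate lower upper s lower≤upper Σlower≤s s≤Σupper
  w = proj₁ interpolated
  lower≤w = proj₁ (proj₂ interpolated)
  w≤upper = proj₁ (proj₂ (proj₂ interpolated))
  Σw = proj₂ (proj₂ (proj₂ interpolated))
  w≤x : ∀ j → w j ≤ x j
  w≤x j = ≤-trans (w≤upper j) (upper≤x j)
  w-fixed : w (suc i) ≡ x (suc i)
  w-fixed = ≤-antisym (w≤x (suc i))
    (subst (_≤ w (suc i)) (updateAt-updates i constant) (lower≤w (suc i)))
  w-min : mOf w ≡ m'
  w-min = ≤-antisym
    (≤-trans (minVec-≤ (tail w) k)
             (subst (w (suc k) ≤_) (updateAt-updates k (tail x)) (w≤upper (suc k))))
    (minVec-greatest (tail w) (λ j → ≤-trans (m'≤lower j) (lower≤w (suc j))))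

-- With at least three counted coordinates, any index has two others, distinct
-- from it and from each other.  This is where n ≥ 3 is used.
twoOthers : ∀ {n3} (i : Fin (3 + n3)) →
            Σ[ k₁ ∈ Fin (3 + n3) ] Σ[ k₂ ∈ Fin (3 + n3) ] k₁ ≢ i × k₂ ≢ i × k₁ ≢ k₂
twoOthers zero             = suc zero , suc (suc zero) , (λ ()) , (λ ()) , (λ ())
twoOthers (suc zero)       = zero , suc (suc zero) , (λ ()) , (λ ()) , (λ ())
twoOthers (suc (suc _))    = zero , suc zero , (λ ()) , (λ ()) , (λ ())

-- With m' = m we keep x_{i₀}; with m' = m − d we either keep x_{i₀} and lower
-- another coordinate k₂ to m', or, if x_{k₂} is too large for that, keep
-- another coordinate k₁ and lower x_{i₀}.
reachable⇒move : ∀ {n3} (x : Position (3 + n3)) {m' y'} →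
                 Reachable (2 + n3) (mOf x) (yOf x) m' y' →
                 Σ[ x' ∈ Position (3 + n3) ] Move x x' × mOf x' ≡ m' × yOf x' ≡ y'
reachable⇒move {n3} x {m'} {y'} r =
  let x' , move , min≡ , total≡s = withTotal r in
  x' , move , min≡ , (begin-equality
    total x' ∸ n * mOf x'   ≡⟨ cong₂ _∸_ total≡s (cong (n *_) min≡) ⟩
    n * m' + y' ∸ n * m'    ≡⟨ m+n∸m≡n (n * m') y' ⟩
    y'                      ∎)
  where
  open ≤-Reasoning
  n = 3 + n3
  m = mOf x
  u = total x
  s = n * m' + y'
  i₀ = proj₁ (minVec-attained (tail x))
  xi₀≡m : x (suc i₀) ≡ m
  xi₀≡m = proj₂ (minVec-attained (tail x))
  m≤x : ∀ j → m ≤ x (suc j)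
  m≤x = minVec-≤ (tail x)
  u≡ : u ≡ n * m + yOf x
  u≡ = total≡ x
  others = twoOthers i₀
  k₁ = proj₁ others
  k₂ = proj₁ (proj₂ others)
  k₁≢i₀ : k₁ ≢ i₀
  k₁≢i₀ = proj₁ (proj₂ (proj₂ others))
  k₂≢i₀ : k₂ ≢ i₀
  k₂≢i₀ = proj₁ (proj₂ (proj₂ (proj₂ others)))
  k₁≢k₂ : k₁ ≢ k₂
  k₁≢k₂ = proj₂ (proj₂ (proj₂ (proj₂ others)))
  lowerBy : ∀ d → 0 < d → m' + d ≡ m → d ≤ y' → y' ≤ yOf x + (2 + n3) * d →
            Σ[ x' ∈ Position n ] Move x x' × mOf x' ≡ m' × total x' ≡ s
  lowerBy d 0<d m'+d≡m d≤y' y'≤ = choose (s + x (suc k₂) ≤? u + m')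
    where
    m'≤m : m' ≤ m
    m'≤m = subst (m' ≤_) m'+d≡m (m≤m+n m' d)
    m'≤x : ∀ j → m' ≤ x (suc j)
    m'≤x j = ≤-trans m'≤m (m≤x j)
    xi₀≡m'+d : x (suc i₀) ≡ m' + d
    xi₀≡m'+d = trans xi₀≡m (sym m'+d≡m)
    -- lowering m by d frees d units of the total: s + d ≤ u
    s+d≤u : s + d ≤ u
    s+d≤u = subst (s + d ≤_) (sym u≡) (begin
      n * m' + y' + d                      ≤⟨ +-monoˡ-≤ d (+-monoʳ-≤ (n * m') y'≤) ⟩
      n * m' + (yOf x + (2 + n3) * d) + d  ≡⟨ regroup n3 m' (yOf x) d ⟩
      n * (m' + d) + yOf x                 ≡⟨ cong (λ a → n * a + yOf x) m'+d≡m ⟩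
      n * m + yOf x                        ∎)
      where
      regroup : ∀ n3 m' y d → (3 + n3) * m' + (y + (2 + n3) * d) + d ≡ (3 + n3) * (m' + d) + y
      regroup = solve-∀
    s<u : s < u
    s<u = <-≤-trans (m<m+n s 0<d) s+d≤u
    choose : Dec (s + x (suc k₂) ≤ u + m') →
             Σ[ x' ∈ Position n ] Move x x' × mOf x' ≡ m' × total x' ≡ s
    choose (yes upS) = fixAndLower x m' s i₀ k₂ m'≤x
                         (λ i₀≡k₂ → ⊥-elim (k₂≢i₀ (sym i₀≡k₂)))
                         lowS upS s<u
      where
      regroup : ∀ a m' d → a * m' + (m' + d) ≡ suc a * m' + d
      regroup = solve-∀
      lowS : (2 + n3) * m' + x (suc i₀) ≤ s
      lowS = begin
        (2 + n3) * m' + x (suc i₀)  ≡⟨ cong ((2 + n3) * m' +_) xi₀≡m'+d ⟩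
        (2 + n3) * m' + (m' + d)    ≡⟨ regroup (2 + n3) m' d ⟩
        n * m' + d                  ≤⟨ +-monoʳ-≤ (n * m') d≤y' ⟩
        s                           ∎
    choose (no ¬upS) = fixAndLower x m' s k₁ i₀ m'≤x
                         (λ k₁≡i₀ → ⊥-elim (k₁≢i₀ k₁≡i₀))
                         lowS upS s<u
      where
      -- the counted coordinates other than k₁ and k₂ are ≥ m
      x₁ = x (suc k₁)
      x₂ = x (suc k₂)
      rest : x₁ + x₂ + (1 + n3) * m ≤ u
      rest = ≤-trans (vsum-≥-two (tail x) k₁ k₂ k₁≢k₂ m≤x)
                     (m≤n+m _ (x zero))
      regroup₁ : ∀ a m' p q → suc a * m' + p + q ≡ p + q + a * m' + m'
      regroup₁ = solve-∀
      lowS : (2 + n3) * m' + x (suc k₁) ≤ s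
      lowS = <⇒≤ (+-cancelʳ-< (x (suc k₂)) _ _ (begin-strict
        (2 + n3) * m' + x₁ + x₂       ≡⟨ regroup₁ (1 + n3) m' x₁ x₂ ⟩
        x₁ + x₂ + (1 + n3) * m' + m'  ≤⟨ +-monoˡ-≤ m' (+-monoʳ-≤ (x₁ + x₂) (*-monoʳ-≤ (1 + n3) m'≤m)) ⟩
        x₁ + x₂ + (1 + n3) * m + m'   ≤⟨ +-monoˡ-≤ m' rest ⟩
        u + m'                        <⟨ ≰⇒> ¬upS ⟩
        s + x₂                        ∎))
      regroup₂ : ∀ s m' d → s + (m' + d) ≡ s + d + m'
      regroup₂ = solve-∀
      upS : s + x (suc i₀) ≤ u + m'
      upS = begin
        s + x (suc i₀)  ≡⟨ cong (s +_) xi₀≡m'+d ⟩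
        s + (m' + d)    ≡⟨ regroup₂ s m' d ⟩
        s + d + m'      ≤⟨ +-monoˡ-≤ m' s+d≤u ⟩
        u + m'          ∎
  withTotal : Reachable (2 + n3) m (yOf x) m' y' →
              Σ[ x' ∈ Position n ] Move x x' × mOf x' ≡ m' × total x' ≡ s
  withTotal (inj₁ (refl , y'<y)) =
    fixAndLower x m s i₀ i₀ m≤x (λ _ → ≤-reflexive xi₀≡m) lowS upS s<u
    where
    s<u : s < u
    s<u = subst (s <_) (sym u≡) (+-monoʳ-< (n * m) y'<y)
    lowS : (2 + n3) * m + x (suc i₀) ≤ s
    lowS = begin
      (2 + n3) * m + x (suc i₀)  ≡⟨ cong ((2 + n3) * m +_) xi₀≡m ⟩
      (2 + n3) * m + m           ≡⟨ +-comm _ m ⟩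
      n * m                      ≤⟨ m≤m+n (n * m) y' ⟩
      s                          ∎
    upS : s + x (suc i₀) ≤ u + m
    upS = +-mono-≤ (<⇒≤ s<u) (≤-reflexive xi₀≡m)
  withTotal (inj₂ (d , 0<d , m'+d≡m , d≤y' , y'≤)) = lowerBy d 0<d m'+d≡m d≤y' y'≤

zOf≡ : ∀ {n} (x : Position n) → zOf x ≡ suc (tri (yOf x))
zOf≡ x = trans (cong (_+ 1) (C2≡tri (yOf x))) (+-comm _ 1)

-- g is the reduced value of (m, y): the case m < z is m ≤ T y, and z − 1 = T y.
g≡reducedValue : ∀ {n1} (x : Position (suc n1)) → g x ≡ reducedValue (suc n1) (mOf x) (yOf x)
g≡reducedValue x with mOf x <? zOf x | mOf x ≤? tri (yOf x)
... | yes _   | yes _   = total≡ x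
... | no _    | no _    = cong (λ z → z ∸ 1 + (mOf x ∸ z) % suc (yOf x)) (zOf≡ x)
... | yes m<z | no m≰T  = ⊥-elim (m≰T (≤-pred (subst (mOf x <_) (zOf≡ x) m<z)))
... | no m≮z  | yes m≤T = ⊥-elim (m≮z (subst (mOf x <_) (sym (zOf≡ x)) (s≤s m≤T)))

-- Sprague–Grundy functions are unique, by induction on the total (bounded
-- by the fuel k): if G x < H x, then some option x' has H x' = G x, but by
-- induction G x' = H x', contradicting the mex property of G.
sg-unique : ∀ {n} (G H : Position n → ℕ) → IsSG G → IsSG H → ∀ x → G x ≡ H x
sg-unique {n} G H G-sg H-sg x = agree (suc (total x)) x ≤-refl
  where
  option-below : ∀ {k} {x x' : Position n} → total x < suc k → Move x x' → total x' < k
  option-below total<k move = ≤-trans (proj₁ (proj₂ move)) (≤-pred total<k)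
  agree : ∀ k (x : Position n) → total x < k → G x ≡ H x
  agree (suc k) x total<k with <-cmp (G x) (H x)
  ... | tri≈ _ G≡H _ = G≡H
  ... | tri< G<H _ _ =
    let x' , move , Hx'≡Gx = proj₂ (H-sg x) (G x) G<H
    in  ⊥-elim (proj₁ (G-sg x) x' move (trans (agree k x' (option-below total<k move)) Hx'≡Gx))
  ... | tri> _ _ H<G =
    let x' , move , Gx'≡Hx = proj₂ (G-sg x) (H x) H<G
    in  ⊥-elim (proj₁ (H-sg x) x' move
                 (trans (sym (agree k x' (option-below total<k move))) Gx'≡Hx))

g-isSG : ∀ n3 → IsSG {3 + n3} g
g-isSG n3 x = optionsDiffer , smallerAttained
  where
  optionsDiffer : ∀ x' → Move x x' → g x' ≢ g x
  optionsDiffer x' move same =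
    reducedValue-distinct (2 + n3) (move⇒option x x' move)
      (trans (sym (g≡reducedValue x')) (trans same (g≡reducedValue x)))
  smallerAttained : ∀ k → k < g x → Σ[ x' ∈ Position (3 + n3) ] Move x x' × g x' ≡ k
  smallerAttained k k<g =
    let m' , y' , reachable , value = reducedValue-mex (2 + n3) (subst (k <_) (g≡reducedValue x) k<g)
        x' , move , m'≡ , y'≡ = reachable⇒move x reachable
    in  x' , move ,
        trans (g≡reducedValue x') (trans (cong₂ (reducedValue (3 + n3)) m'≡ y'≡) value)

theorem3p1 : (n : ℕ) → 3 ≤ n →
    IsSG {n} g × (∀ (G : Position n → ℕ) → IsSG G → ∀ x → G x ≡ g x)
theorem3p1 (suc (suc (suc n3))) _ = g-isSG n3 , λ G G-sg → sg-unique G g G-sg (g-isSG n3)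
theorem3p1 (suc zero)       (s≤s ())
theorem3p1 (suc (suc zero)) (s≤s (s≤s ()))
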